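{- Let $(\Psi_d)_d$ be a constraint structure with both a meet operation $\wedge$ and a lift, let $(\preceq,\wedge,P)$ be decent, and let $(\mathcal R^d)_d$ be a constraint-refining predicate that relates to a constraint-producing predicate $(\models^d)_d$ (axioms A1, A2). If $\vdash^{d}\Gamma\to\sigma'$ is derivable in DI, then for all $\sigma\in\Psi_d$ such that $P(\sigma\wedge\sigma')$ and for all sequentialisations $r$, there exists $\sigma''\in\Psi_d$ such that $\sigma''\equiv\sigma\wedge\sigma'$ and $\sigma\to\vdash^{d}\Gamma\to\sigma''$ is derivable in SDI with a proof tree that follows $r$.
   Context: Formulae: first-order, negation normal form (literals, $\wedge,\vee,\forall,\exists$). There are eigenvariables ($\bar x$) and meta-variables ($X$). Domains: initial domain $d_0$; $d;\bar x$ (resp. $d;X$) extends $d$ by a fresh eigenvariable (meta-variable). Terms/formulae of domain $d$ have (free) variables among those declared in $d$. A context of domain $d$ is a multiset of formulae of domain $d$; $\Gamma_{lit}$ is its set of literals. A constraint structure: sets $(\Psi_d)_d$ with $\Psi_{d;\bar x}=\Psi_d$ and projections $\Psi_{d;X}\to\Psi_d$, $\sigma\mapsto\sigma{\downarrow}$; here also a binary operation $\wedge$ on each $\Psi_d$ and lift maps $\Psi_d\to\Psi_{d;X}$, $\sigma\mapsto\sigma{\uparrow}$. Decency: $\preceq$ is a family of preorders on the $\Psi_d$, $\equiv$ the equivalence generated by $\preceq$, $P$ a family of predicates; $(\preceq,\wedge,P)$ is decent if (D1) $\sigma\wedge\sigma'$ is a greatest lower bound of $\sigma,\sigma'$ for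 $\preceq$; (D2) for $\sigma\in\Psi_d$, $\sigma',\sigma''\in\Psi_{d;X}$: $\sigma''\equiv\sigma{\uparrow}\wedge\sigma'\Rightarrow\sigma''{\downarrow}\equiv\sigma\wedge\sigma'{\downarrow}$; (P1) for $\sigma\in\Psi_{d;X}$, $P(\sigma)\Leftrightarrow P(\sigma{\downarrow})$; (P2) $P(\sigma)$ and $\sigma\preceq\sigma'$ imply $P(\sigma')$. A constraint-producing predicate: relations $\mathcal A\models^d\sigma$ ($\mathcal A$ a set of literals of domain $d$, $\sigma\in\Psi_d$). A constraint-refining predicate: relations $\mathcal R^d(\sigma,\mathcal A,\sigma')$ with $\sigma,\sigma'\in\Psi_d$. It relates to $(\models^d)_d$ if for all $d,\mathcal A,\sigma\in\Psi_d$: (A1) for all $\sigma'$, $\mathcal R^d(\sigma,\mathcal A,\sigma')$ implies there is $\sigma''\in\Psi_d$ with $\sigma'\equiv\sigma\wedge\sigma''$, $P(\sigma\wedge\sigma'')$ and $\mathcal A\models^d\sigma''$; (A2) for all $\sigma'$, if $P(\sigma\wedge\sigma')$ and $\mathcal A\models^d\sigma'$ then there is $\sigma''$ with $\sigma''\equiv\sigma\wedge\sigma'$ and $\mathcal R^d(\sigma,\mathcal A,\sigma'')$. DI rules (sequents $\vdash^d\Gamma\to\sigma$): $\vdash^d\Gamma\to\sigma$ if $\Gamma_{lit}\models^d\sigma$; from $\vdash^d\Gamma,A\to\sigma$ and $\vdash^d\Gamma,B\to\sigma'$ infer $\vdash^d\Gamma,A\wedge B\to\sigma\wedge\sigma'$;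 from $\vdash^d\Gamma,A,B\to\sigma$ infer $\vdash^d\Gamma,A\vee B\to\sigma$; from $\vdash^{d;X}\Gamma,A[x:=X],\exists xA\to\sigma$ infer $\vdash^d\Gamma,\exists xA\to\sigma{\downarrow}$ ($X$ fresh); from $\vdash^{d;\bar x}\Gamma,A[x:=\bar x]\to\sigma$ infer $\vdash^d\Gamma,\forall xA\to\sigma$ ($\bar x$ fresh). SDI rules (sequents $\sigma\to\vdash^d\Gamma\to\sigma'$): $\sigma\to\vdash^d\Gamma\to\sigma'$ if $\mathcal R^d(\sigma,\Gamma_{lit},\sigma')$; from $\sigma\to\vdash^d\Gamma,A,B\to\sigma'$ infer $\sigma\to\vdash^d\Gamma,A\vee B\to\sigma'$; for $i\in\{0,1\}$, from $\sigma\to\vdash^d\Gamma,A_i\to\sigma''$ and $\sigma''\to\vdash^d\Gamma,A_{1-i}\to\sigma'$ infer $\sigma\to\vdash^d\Gamma,A_0\wedge A_1\to\sigma'$; from $\sigma{\uparrow}\to\vdash^{d;X}\Gamma,A[x:=X],\exists xA\to\sigma'$ infer $\sigma\to\vdash^d\Gamma,\exists xA\to\sigma'{\downarrow}$ ($X$ fresh); from $\sigma\to\vdash^{d;\bar x}\Gamma,A[x:=\bar x]\to\sigma'$ infer $\sigma\to\vdash^d\Gamma,\forall xA\to\sigma'$ ($\bar x$ fresh). A sequentialisation is an infinite binary tree with nodes labelled "black" or "white". An SDI proof tree $\pi$ follows $r$ (by induction on $\pi$): if its last rule has no premiss, always; if one premiss, iff the sub-tree follows $r$; if its last rule is the $\wedge$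 rule with index $i$, first premiss sub-tree $\pi_i$ (for $A_i$) and second $\pi_{1-i}$ (for $A_{1-i}$), iff $\pi_i$ follows the left subtree of $r$, $\pi_{1-i}$ follows the right subtree of $r$, and either $i=0$ and the root of $r$ is white, or $i=1$ and the root of $r$ is black. -}

module Defs where

open import Data.Nat using (ℕ; zero; suc)
open import Data.Fin using (Fin; zero; suc)
open import Data.Bool using (Bool)
open import Data.Unit using (⊤)
open import Data.List using (List; []; _∷_; length; map)
open import Data.Vec using (Vec; []; _∷_)
open import Data.Product using (Σ; _×_; _,_; ∃)
open import Data.List.Membership.Propositional using (_∈_)
open import Data.List.Relation.Binary.Permutation.Propositional using (_↭_)
open import Relation.Binary.PropositionalEquality using (_≡_)
open import Relation.Binary.Structures using (IsPreorder)

-- A domain is the initial domain d₀ = [] extended by a sequence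
-- of fresh variables, the most recent one at the head:  d;x̄ = eigen ∷ d,
-- d;X = meta ∷ d.  The free variables of domain d are Fin (length d),
-- index zero being the most recently declared one (hence always fresh).

data Kind : Set where
  eigen meta : Kind

Domain : Set
Domain = List Kind

d₀ : Domain
d₀ = []

-- The "key" of a domain: strip the trailing eigenvariable declarations.
-- Constraint sets are indexed by keys, which makes Ψ_{d;x̄} = Ψ_d hold
-- definitionally while Ψ_{d;X} is arbitrary.
key : Domain → Domain
key []          = []
key (eigen ∷ d) = key d
key (meta ∷ d)  = meta ∷ d

record Signature : Set₁ where
  field
    Fun    : Set
    fArity : Fun → ℕ
    Pred   : Set
    pArity : Pred → ℕ

module Syntax (S : Signature) where
  open Signature S

  -- Terms of domain d with n bound variables (de Bruijn *levels*:
  -- bound index zero is the outermost enclosing binder).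
  data Term (d : Domain) (n : ℕ) : Set where
    fv  : Fin (length d) → Term d n
    bv  : Fin n → Term d n
    app : (f : Fun) → Vec (Term d n) (fArity f) → Term d n

  -- Literals: an atom with a polarity (true = positive, false = negated).
  record Literal (d : Domain) (n : ℕ) : Set where
    constructor lit
    field
      pos  : Bool
      pred : Pred
      args : Vec (Term d n) (pArity pred)

  data Formula (d : Domain) (n : ℕ) : Set where
    atom      : Literal d n → Formula d n
    _∧ᶠ_ _∨ᶠ_ : Formula d n → Formula d n → Formula d n
    ∀ᶠ ∃ᶠ     : Formula d (suc n) → Formula d n

  Lit : Domain → Set
  Lit d = Literal d 0

  Form : Domain → Set
  Form d = Formula d 0

  mutual
    wkT : ∀ {k d n} → Term d n → Term (k ∷ d) n
    wkT (fv i)     = fv (suc i)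
    wkT (bv i)     = bv i
    wkT (app f ts) = app f (wkTs ts)

    wkTs : ∀ {k d n m} → Vec (Term d n) m → Vec (Term (k ∷ d) n) m
    wkTs []       = []
    wkTs (t ∷ ts) = wkT t ∷ wkTs ts

  wkL : ∀ {k d n} → Literal d n → Literal (k ∷ d) n
  wkL (lit b p ts) = lit b p (wkTs ts)

  wkF : ∀ {k d n} → Formula d n → Formula (k ∷ d) n
  wkF (atom l)  = atom (wkL l)
  wkF (A ∧ᶠ B)  = wkF A ∧ᶠ wkF B
  wkF (A ∨ᶠ B)  = wkF A ∨ᶠ wkF B
  wkF (∀ᶠ A)    = ∀ᶠ (wkF A)
  wkF (∃ᶠ A)    = ∃ᶠ (wkF A)

  mutual
    instT : ∀ {k d n} → Term d (suc n) → Term (k ∷ d) n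
    instT (fv i)       = fv (suc i)
    instT (bv zero)    = fv zero
    instT (bv (suc i)) = bv i
    instT (app f ts)   = app f (instTs ts)

    instTs : ∀ {k d n m} → Vec (Term d (suc n)) m → Vec (Term (k ∷ d) n) m
    instTs []       = []
    instTs (t ∷ ts) = instT t ∷ instTs ts

  instL : ∀ {k d n} → Literal d (suc n) → Literal (k ∷ d) n
  instL (lit b p ts) = lit b p (instTs ts)

  instF : ∀ {k d n} → Formula d (suc n) → Formula (k ∷ d) n
  instF (atom l)  = atom (instL l)
  instF (A ∧ᶠ B)  = instF A ∧ᶠ instF B
  instF (A ∨ᶠ B)  = instF A ∨ᶠ instF B
  instF (∀ᶠ A)    = ∀ᶠ (instF A)
  instF (∃ᶠ A)    = ∃ᶠ (instF A)

  _[x:=fresh] : ∀ {k d} → Formula d 1 → Form (k ∷ d)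
  A [x:=fresh] = instF A

  -- Contexts of domain d: multisets of formulae, represented as lists
  -- taken up to permutation (every rule concludes on any permutation).
  Context : Domain → Set
  Context d = List (Form d)

  wkC : ∀ {k d} → Context d → Context (k ∷ d)
  wkC = map wkF

  _ₗᵢₜ : ∀ {d} → Context d → Lit d → Set
  (Γ ₗᵢₜ) l = atom l ∈ Γ

record ConstraintStructure : Set₁ where
  field
    -- Ψ₀ k is Ψ_d for any domain d with key d ≡ k (see Ψ below)
    Ψ₀  : Domain → Set
    _↓  : ∀ {d} → Ψ₀ (meta ∷ d) → Ψ₀ (key d)
    _∧_ : ∀ {k} → Ψ₀ k → Ψ₀ k → Ψ₀ k
    lift : ∀ d → Ψ₀ (key d) → Ψ₀ (meta ∷ d)

  infixr 6 _∧_

  Ψ : Domain → Set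
  Ψ d = Ψ₀ (key d)

record Decent (CS : ConstraintStructure) : Set₁ where
  open ConstraintStructure CS
  field
    _⪯_ : ∀ {k} → Ψ₀ k → Ψ₀ k → Set
    ⪯-isPreorder : ∀ {k} → IsPreorder (_≡_ {A = Ψ₀ k}) _⪯_
    P   : ∀ {k} → Ψ₀ k → Set

  _≈_ : ∀ {k} → Ψ₀ k → Ψ₀ k → Set
  σ ≈ σ' = (σ ⪯ σ') × (σ' ⪯ σ)

  field
    D1 : ∀ {k} (σ σ' : Ψ₀ k) →
         ((σ ∧ σ') ⪯ σ) × ((σ ∧ σ') ⪯ σ') ×
         (∀ τ → τ ⪯ σ → τ ⪯ σ' → τ ⪯ (σ ∧ σ'))
    D2 : ∀ {d} (σ : Ψ d) (σ' σ'' : Ψ (meta ∷ d)) →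
         σ'' ≈ (lift d σ ∧ σ') → (σ'' ↓) ≈ (σ ∧ (σ' ↓))
    P1 : ∀ {d} (σ : Ψ (meta ∷ d)) → (P σ → P (σ ↓)) × (P (σ ↓) → P σ)
    P2 : ∀ {k} (σ σ' : Ψ₀ k) → P σ → σ ⪯ σ' → P σ'

module _ (S : Signature) (CS : ConstraintStructure) where
  open Syntax S
  open ConstraintStructure CS

  ProducingPredicate : Set₁
  ProducingPredicate = ∀ {d} → (Lit d → Set) → Ψ d → Set

  RefiningPredicate : Set₁
  RefiningPredicate = ∀ {d} → Ψ d → (Lit d → Set) → Ψ d → Set

  record Relates (Dc : Decent CS) (_⊨_ : ProducingPredicate)
                 (ℛ : RefiningPredicate) : Set₁ where
    open Decent Dc
    field
      A1 : ∀ {d} (𝒜 : Lit d → Set) (σ σ' : Ψ d) → ℛ σ 𝒜 σ' →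
           Σ (Ψ d) λ σ'' → (σ' ≈ (σ ∧ σ'')) × P (σ ∧ σ'') × (𝒜 ⊨ σ'')
      A2 : ∀ {d} (𝒜 : Lit d → Set) (σ σ' : Ψ d) →
           P (σ ∧ σ') → 𝒜 ⊨ σ' →
           Σ (Ψ d) λ σ'' → (σ'' ≈ (σ ∧ σ')) × ℛ σ 𝒜 σ''

  data DI (_⊨_ : ProducingPredicate) : (d : Domain) → Context d → Ψ d → Set where
    di-ax : ∀ {d} {Γ : Context d} {σ : Ψ d} →
            (Γ ₗᵢₜ) ⊨ σ → DI _⊨_ d Γ σ
    di-∧  : ∀ {d} {Γ Δ : Context d} {A B σ σ'} →
            DI _⊨_ d (A ∷ Γ) σ → DI _⊨_ d (B ∷ Γ) σ' →
            Δ ↭ ((A ∧ᶠ B) ∷ Γ) → DI _⊨_ d Δ (σ ∧ σ')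
    di-∨  : ∀ {d} {Γ Δ : Context d} {A B σ} →
            DI _⊨_ d (A ∷ B ∷ Γ) σ →
            Δ ↭ ((A ∨ᶠ B) ∷ Γ) → DI _⊨_ d Δ σ
    di-∃  : ∀ {d} {Γ Δ : Context d} {A : Formula d 1} {σ} →
            DI _⊨_ (meta ∷ d) (A [x:=fresh] ∷ wkF (∃ᶠ A) ∷ wkC Γ) σ →
            Δ ↭ (∃ᶠ A ∷ Γ) → DI _⊨_ d Δ (σ ↓)
    di-∀  : ∀ {d} {Γ Δ : Context d} {A : Formula d 1} {σ} →
            DI _⊨_ (eigen ∷ d) (A [x:=fresh] ∷ wkC Γ) σ →
            Δ ↭ (∀ᶠ A ∷ Γ) → DI _⊨_ d Δ σ

  data SDI (ℛ : RefiningPredicate) : (d : Domain) → Ψ d → Context d → Ψ d → Set where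
    sdi-ax : ∀ {d} {Γ : Context d} {σ σ' : Ψ d} →
             ℛ σ (Γ ₗᵢₜ) σ' → SDI ℛ d σ Γ σ'
    sdi-∨  : ∀ {d} {Γ Δ : Context d} {A B σ σ'} →
             SDI ℛ d σ (A ∷ B ∷ Γ) σ' →
             Δ ↭ ((A ∨ᶠ B) ∷ Γ) → SDI ℛ d σ Δ σ'
    sdi-∧₀ : ∀ {d} {Γ Δ : Context d} {A₀ A₁ σ σ'' σ'} →
             SDI ℛ d σ (A₀ ∷ Γ) σ'' → SDI ℛ d σ'' (A₁ ∷ Γ) σ' →
             Δ ↭ ((A₀ ∧ᶠ A₁) ∷ Γ) → SDI ℛ d σ Δ σ'
    sdi-∧₁ : ∀ {d} {Γ Δ : Context d} {A₀ A₁ σ σ'' σ'} →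
             SDI ℛ d σ (A₁ ∷ Γ) σ'' → SDI ℛ d σ'' (A₀ ∷ Γ) σ' →
             Δ ↭ ((A₀ ∧ᶠ A₁) ∷ Γ) → SDI ℛ d σ Δ σ'
    sdi-∃  : ∀ {d} {Γ Δ : Context d} {A : Formula d 1} {σ σ'} →
             SDI ℛ (meta ∷ d) (lift d σ) (A [x:=fresh] ∷ wkF (∃ᶠ A) ∷ wkC Γ) σ' →
             Δ ↭ (∃ᶠ A ∷ Γ) → SDI ℛ d σ Δ (σ' ↓)
    sdi-∀  : ∀ {d} {Γ Δ : Context d} {A : Formula d 1} {σ σ'} →
             SDI ℛ (eigen ∷ d) σ (A [x:=fresh] ∷ wkC Γ) σ' →
             Δ ↭ (∀ᶠ A ∷ Γ) → SDI ℛ d σ Δ σ'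

-- Sequentialisations: infinite binary trees with black/white nodes,
-- represented as colourings of all finite paths from the root.

data Colour : Set where
  black white : Colour

data Dir : Set where
  left right : Dir

Sequentialisation : Set
Sequentialisation = List Dir → Colour

root : Sequentialisation → Colour
root r = r []

leftSub rightSub : Sequentialisation → Sequentialisation
leftSub  r p = r (left ∷ p)
rightSub r p = r (right ∷ p)

module _ {S : Signature} {CS : ConstraintStructure} {ℛ : RefiningPredicate S CS} where

  Follows : ∀ {d σ Γ σ'} → SDI S CS ℛ d σ Γ σ' → Sequentialisation → Set
  Follows (sdi-ax _)       r = ⊤
  Follows (sdi-∨ π _)      r = Follows π r
  Follows (sdi-∧₀ π₀ π₁ _) r = Follows π₀ (leftSub r) × Follows π₁ (rightSub r) × (root r ≡ white)
  Follows (sdi-∧₁ π₁ π₀ _) r = Follows π₁ (leftSub r) × Follows π₀ (rightSub r) × (root r ≡ black)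
  Follows (sdi-∃ π _)      r = Follows π r
  Follows (sdi-∀ π _)      r = Follows π r

module Submission where

-- The proof is by induction on the DI derivation, with the statement
-- generalised over σ and r ("the conclusion is translatable").  Every DI
-- rule has an SDI counterpart; what has to be checked is the bookkeeping
-- of constraints, which lives entirely in the algebra of ∧:
--   * by (D1), each Ψ_d ordered by ⪯ is a meet-semilattice up to the
--     induced equivalence, so the library supplies congruence,
--     commutativity, associativity and monotonicity of ∧;
--   * the ∧ rule is the only one that threads constraints: it refines σ
--     by the first branch to x ≡ σ ∧ σ₀ and x by the second branch to
--     τ ≡ x ∧ σ₁ ≡ σ ∧ (σ₀ ∧ σ₁); the colour of the root of r decides which
--     branch goes first, commutativity handling the black case;
--   * the ∃ rule moves between Ψ_d and Ψ_{d;X}, using (D2), (P1) and (P2).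

open import Level using (0ℓ)
open import Data.List using (_∷_)
open import Data.List.Relation.Binary.Permutation.Propositional using (_↭_)
open import Data.Product using (Σ; _×_; _,_; proj₁; proj₂)
open import Data.Unit using (tt)
open import Relation.Binary.Lattice using (MeetSemilattice)
open import Relation.Binary.Structures using (IsPreorder)
import Relation.Binary.Lattice.Properties.MeetSemilattice as MeetProperties
open import Defs

module ConstraintAlgebra (CS : ConstraintStructure) (Dc : Decent CS) where
  open ConstraintStructure CS
  open Decent Dc

  module _ {k : Domain} where
    open IsPreorder (⪯-isPreorder {k}) public
      using () renaming (refl to ⪯-refl; trans to ⪯-trans)

  meetSemilattice : ∀ k → MeetSemilattice 0ℓ 0ℓ 0ℓ
  meetSemilattice k = record
    { Carrier = Ψ₀ k
    ; _≈_ = _≈_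
    ; _≤_ = _⪯_
    ; _∧_ = _∧_
    ; isMeetSemilattice = record
      { isPartialOrder = record
        { isPreorder = record
          { isEquivalence = record
            { refl  = ⪯-refl , ⪯-refl
            ; sym   = λ (p , q) → q , p
            ; trans = λ (p , q) (p' , q') → ⪯-trans p p' , ⪯-trans q' q
            }
          ; reflexive = proj₁
          ; trans = ⪯-trans
          }
        ; antisym = _,_
        }
      ; infimum = D1
      }
    }

  module _ {k : Domain} where
    open MeetSemilattice (meetSemilattice k) public
      using (x∧y≤x)
    open MeetSemilattice.Eq (meetSemilattice k) public
      using () renaming (refl to ≈-refl; sym to ≈-sym; trans to ≈-trans)
    open MeetProperties (meetSemilattice k) public
      using (∧-cong; ∧-comm; ∧-assoc; ∧-monotonic)

  P-resp-≈ : ∀ {k} {a b : Ψ₀ k} → a ≈ b → P a → P b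
  P-resp-≈ a≈b pa = P2 _ _ pa (proj₁ a≈b)

  meet-sequence : ∀ {k} {σ a b x τ : Ψ₀ k} →
                  x ≈ (σ ∧ a) → τ ≈ (x ∧ b) → τ ≈ (σ ∧ (a ∧ b))
  meet-sequence {σ = σ} {a} {b} x≈ τ≈ =
    ≈-trans τ≈ (≈-trans (∧-cong x≈ ≈-refl) (∧-assoc σ a b))

  P-first : ∀ {k} {σ a b : Ψ₀ k} → P (σ ∧ (a ∧ b)) → P (σ ∧ a)
  P-first {a = a} {b} p = P2 _ _ p (∧-monotonic ⪯-refl (x∧y≤x a b))

  P-second : ∀ {k} {σ a b x : Ψ₀ k} → P (σ ∧ (a ∧ b)) → x ≈ (σ ∧ a) → P (x ∧ b)
  P-second p x≈ = P-resp-≈ (≈-sym (meet-sequence x≈ ≈-refl)) p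

  -- Admissibility transfers from σ ∧ σ'↓ in Ψ_d to lift σ ∧ σ' in Ψ_{d;X}:
  -- by (D2) the projection of lift σ ∧ σ' is equivalent to σ ∧ σ'↓.
  P-lift : ∀ {d} (σ : Ψ d) (σ' : Ψ (meta ∷ d)) →
           P (σ ∧ (σ' ↓)) → P (lift d σ ∧ σ')
  P-lift {d} σ σ' p =
    proj₂ (P1 (lift d σ ∧ σ')) (P-resp-≈ (≈-sym (D2 σ σ' _ ≈-refl)) p)

module Translation (S : Signature) (CS : ConstraintStructure) (Dc : Decent CS)
    (_⊨_ : ProducingPredicate S CS) (ℛ : RefiningPredicate S CS)
    (Rel : Relates S CS Dc _⊨_ ℛ) where
  open Syntax S
  open ConstraintStructure CS
  open Decent Dc
  open Relates Rel
  open ConstraintAlgebra CS Dc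

  SDI-following : ∀ d → Ψ d → Context d → Ψ d → Sequentialisation → Set
  SDI-following d σ Γ σ' r =
    Σ (Ψ d) λ σ'' → (σ'' ≈ (σ ∧ σ')) × Σ (SDI S CS ℛ d σ Γ σ'') λ π → Follows π r

  Translatable : ∀ d → Context d → Ψ d → Set
  Translatable d Γ σ' =
    (σ : Ψ d) → P (σ ∧ σ') → (r : Sequentialisation) → SDI-following d σ Γ σ' r

  translate-ax : ∀ {d} {Γ : Context d} {σ'} → (Γ ₗᵢₜ) ⊨ σ' → Translatable d Γ σ'
  translate-ax {Γ = Γ} {σ'} Γ⊨σ' σ p r =
    let (σ'' , σ''≈ , refines) = A2 (Γ ₗᵢₜ) σ σ' p Γ⊨σ'
    in σ'' , σ''≈ , sdi-ax refines , tt

  translate-∨ : ∀ {d} {Γ Δ : Context d} {A B σ'} →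
                Translatable d (A ∷ B ∷ Γ) σ' → Δ ↭ ((A ∨ᶠ B) ∷ Γ) →
                Translatable d Δ σ'
  translate-∨ premise perm σ p r =
    let (σ'' , σ''≈ , π , follows) = premise σ p r
    in σ'' , σ''≈ , sdi-∨ π perm , follows

  -- ∀: Ψ_{d;x̄} = Ψ_d, so the constraint is untouched as well.
  translate-∀ : ∀ {d} {Γ Δ : Context d} {A : Formula d 1} {σ'} →
                Translatable (eigen ∷ d) (A [x:=fresh] ∷ wkC Γ) σ' →
                Δ ↭ (∀ᶠ A ∷ Γ) → Translatable d Δ σ'
  translate-∀ premise perm σ p r =
    let (σ'' , σ''≈ , π , follows) = premise σ p r
    in σ'' , σ''≈ , sdi-∀ π perm , follows

  translate-∃ : ∀ {d} {Γ Δ : Context d} {A : Formula d 1} {σ'} →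
                Translatable (meta ∷ d) (A [x:=fresh] ∷ wkF (∃ᶠ A) ∷ wkC Γ) σ' →
                Δ ↭ (∃ᶠ A ∷ Γ) → Translatable d Δ (σ' ↓)
  translate-∃ {d} {σ' = σ'} premise perm σ p r =
    let (τ , τ≈ , π , follows) = premise (lift d σ) (P-lift σ σ' p) r
    in τ ↓ , D2 σ σ' τ τ≈ , sdi-∃ π perm , follows

  translate-∧ : ∀ {d} {Γ Δ : Context d} {A₀ A₁ σ₀ σ₁} →
                Translatable d (A₀ ∷ Γ) σ₀ → Translatable d (A₁ ∷ Γ) σ₁ →
                Δ ↭ ((A₀ ∧ᶠ A₁) ∷ Γ) → Translatable d Δ (σ₀ ∧ σ₁)
  translate-∧ premise₀ premise₁ perm σ p r with root r in colour
  ... | white =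
    let (x , x≈ , π₀ , follows₀) = premise₀ σ (P-first p) (leftSub r)
        (τ , τ≈ , π₁ , follows₁) = premise₁ x (P-second p x≈) (rightSub r)
    in τ , meet-sequence x≈ τ≈ , sdi-∧₀ π₀ π₁ perm , follows₀ , follows₁ , colour
  ... | black =
    let swap≈ = ∧-cong ≈-refl (∧-comm _ _)
        p'    = P-resp-≈ (≈-sym swap≈) p
        (x , x≈ , π₁ , follows₁) = premise₁ σ (P-first p') (leftSub r)
        (τ , τ≈ , π₀ , follows₀) = premise₀ x (P-second p' x≈) (rightSub r)
    in τ , ≈-trans (meet-sequence x≈ τ≈) swap≈ ,
       sdi-∧₁ π₁ π₀ perm , follows₁ , follows₀ , colour

  translate : ∀ {d} {Γ : Context d} {σ'} → DI S CS _⊨_ d Γ σ' → Translatable d Γ σ'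
  translate (di-ax Γ⊨σ)        = translate-ax Γ⊨σ
  translate (di-∧ D₀ D₁ perm)  = translate-∧ (translate D₀) (translate D₁) perm
  translate (di-∨ D perm)      = translate-∨ (translate D) perm
  translate (di-∃ D perm)      = translate-∃ (translate D) perm
  translate (di-∀ D perm)      = translate-∀ (translate D) perm

theorem4 : (S : Signature) (CS : ConstraintStructure) (Dc : Decent CS)
           (_⊨_ : ProducingPredicate S CS) (ℛ : RefiningPredicate S CS) →
           Relates S CS Dc _⊨_ ℛ →
           ∀ {d} {Γ : Syntax.Context S d} {σ' : ConstraintStructure.Ψ CS d} →
           DI S CS _⊨_ d Γ σ' →
           (σ : ConstraintStructure.Ψ CS d) →
           Decent.P Dc (ConstraintStructure._∧_ CS σ σ') →
           (r : Sequentialisation) →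
           Σ (ConstraintStructure.Ψ CS d) λ σ'' →
             Decent._≈_ Dc σ'' (ConstraintStructure._∧_ CS σ σ') ×
             Σ (SDI S CS ℛ d σ Γ σ'') λ π → Follows π r
theorem4 S CS Dc _⊨_ ℛ Rel = Translation.translate S CS Dc _⊨_ ℛ Rel
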